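{- Let $l\ge2$, let $j\in\mathbb{Z}$, and let $(\lambda,j)$ be a $j$-core abacus of type $C_l^{(1)}$. Then: (1) if position $i$ carries a bead, then position $i-2l$ carries a bead; (2) if position $i$ is empty, then position $i+2l$ is empty.
   Context: For a partition $\lambda$ and an integer $j$ (the charge), the abacus $(\lambda,j)$ is the set $\beta_j(\lambda)=\{\lambda_i-i+j: i\ge1\}\subseteq\mathbb{Z}$. Position $x\in\mathbb{Z}$ carries a bead iff $x\in\beta_j(\lambda)$, and is empty otherwise. For $0\le i\le l$, let $s_i$ be the operator on subsets $S\subseteq\mathbb{Z}$ defined as follows. For every $x\in\mathbb{Z}$ with $x+1\equiv i$ or $x+1\equiv -i\pmod{2l}$, $s_i$ exchanges the membership of $x$ and $x+1$ in $S$; all other positions are unchanged. These operators encode the affine Weyl group of type $C_l^{(1)}$ acting on abaci, where $f_i$ moves a bead from $x$ to an empty position $x+1$ with $x+1\equiv\pm i\pmod{2l}$. $(\lambda,j)$ is a $j$-core abacus of type $C_l^{(1)}$ if $\beta_j(\lambda)$ lies in the orbit of $\mathbb{Z}_{<j}$ (the abacus $(\varnothing,j)$) under the group generated by $s_0,\dots,s_l$. Equivalently, no elementary operation can be performed on it, or its weight has defect zero. -}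

module Defs where

open import Data.Nat using (ℕ; zero; suc; _≥_)
open import Data.Integer using (ℤ; +_; _+_; _-_; -_; _*_; _<_)
open import Data.Integer.Divisibility using (_∣_)
open import Data.Fin using (Fin; toℕ)
open import Data.List using (List; []; _∷_)
open import Data.List.Relation.Unary.Linked using (Linked)
open import Data.Product using (_×_; ∃)
open import Data.Sum using (_⊎_)
open import Relation.Nullary using (¬_)
open import Relation.Binary.PropositionalEquality using (_≡_)

-- A partition: a weakly decreasing finite list of parts
-- (trailing zero parts are harmless: λ_i = 0 beyond the list anyway).
record Partition : Set where
  constructor mkPartition
  field
    parts      : List ℕ
    decreasing : Linked _≥_ parts
open Partition public

-- part μ k = λ_{k+1}  (0-indexed), zero beyond the list.
partAt : List ℕ → ℕ → ℕ
partAt []       _       = 0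
partAt (p ∷ ps) zero    = p
partAt (p ∷ ps) (suc k) = partAt ps k

SubsetZ : Set₁
SubsetZ = ℤ → Set

-- The abacus β_j(λ) = { λ_i - i + j : i ≥ 1 }  (here i = suc k).
β : Partition → ℤ → SubsetZ
β μ j x = ∃ λ (k : ℕ) → x ≡ (+ partAt (parts μ) k) - + (suc k) + j

-- ℤ_{<j}, the abacus (∅, j).
Zlt : ℤ → SubsetZ
Zlt j x = x < j

_≡_[mod2l_] : ℤ → ℤ → ℕ → Set
a ≡ b [mod2l l ] = (+ (2 Data.Nat.* l)) ∣ (a - b)

-- y+1 ≡ i or y+1 ≡ -i (mod 2l): y is the left end of an exchanged pair.
LeftEnd : ℕ → ℕ → ℤ → Set
LeftEnd l i y = ((y + + 1) ≡ + i [mod2l l ]) ⊎ ((y + + 1) ≡ - (+ i) [mod2l l ])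

RightEnd : ℕ → ℕ → ℤ → Set
RightEnd l i y = LeftEnd l i (y - + 1)

s : (l i : ℕ) → SubsetZ → SubsetZ
s l i S y =
    (LeftEnd l i y × S (y + + 1))
  ⊎ (RightEnd l i y × S (y - + 1))
  ⊎ (¬ LeftEnd l i y × ¬ RightEnd l i y × S y)

-- Apply a word in the generators s_0, …, s_l (rightmost first).
applyWord : (l : ℕ) → List (Fin (suc l)) → SubsetZ → SubsetZ
applyWord l []       S = S
applyWord l (i ∷ w)  S = s l (toℕ i) (applyWord l w S)

_≐_ : SubsetZ → SubsetZ → Set
A ≐ B = ∀ x → (A x → B x) × (B x → A x)

-- (λ, j) is a j-core abacus of type C_l^(1): β_j(λ) lies in the orbit
-- of ℤ_{<j} under the group generated by s_0,…,s_l (each s_i is an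
-- involution, so the group elements are exactly the finite words).
IsCoreC : (l : ℕ) → Partition → ℤ → Set
IsCoreC l μ j = ∃ λ (w : List (Fin (suc l))) → β μ j ≐ applyWord l w (Zlt j)

-- Every s_i exchanges x and x + 1 for a set of pairs {x, x + 1} that is
-- invariant under translation by multiples of 2l, so s_i preserves the
-- property "S x implies S (x + d)" whenever 2l divides d.  The empty
-- abacus ℤ_{<j} has this property for every d ≤ 0, hence so does every
-- abacus in its orbit; (1) is the case d = -2l and (2) is its contrapositive.
module Submission where

open import Defs
open import Data.Nat using (ℕ; _≥_)
open import Data.Integer using (ℤ; +_; _+_; _-_; -_; _≤_; 0ℤ)
open import Data.Integer.Properties
  using (≤-<-trans; ≤-trans; ≤-reflexive; +-monoʳ-≤; +-identityʳ; neg-≤-pos)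
open import Data.Integer.Divisibility using () renaming (_∣_ to _∣ᵤ_)
open import Data.Integer.Divisibility.Signed
  using (∣ᵤ⇒∣; ∣⇒∣ᵤ; ∣m∣n⇒∣m+n; ∣m⇒∣-m; ∣-refl)
  renaming (_∣_ to _∣ₛ_)
open import Data.Integer.Tactic.RingSolver using (solve-∀)
open import Data.List using ([]; _∷_)
open import Data.Product using (_×_; _,_; proj₁; proj₂)
open import Data.Sum using (inj₁; inj₂)
open import Relation.Nullary using (¬_)
open import Relation.Binary.PropositionalEquality using (_≡_; subst; sym)

modulus : ℕ → ℤ
modulus l = + (2 Data.Nat.* l)

ShiftClosed : ℤ → SubsetZ → Set
ShiftClosed d S = ∀ x → S x → S (x + d)

private
  -+-comm : ∀ a t d → (a + d) - t ≡ (a - t) + d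
  -+-comm = solve-∀

  +1-+-comm : ∀ y d → (y + d) + + 1 ≡ (y + + 1) + d
  +1-+-comm = solve-∀

  -1-+-comm : ∀ y d → (y + d) - + 1 ≡ (y - + 1) + d
  -1-+-comm = solve-∀

  +-neg-cancelʳ : ∀ y d → (y + d) + - d ≡ y
  +-neg-cancelʳ = solve-∀

  +-minus-cancelʳ : ∀ y d → (y + d) - d ≡ y
  +-minus-cancelʳ = solve-∀

module _ (l : ℕ) where

  mod2l-+ : ∀ {d} → modulus l ∣ₛ d → ∀ a t → a ≡ t [mod2l l ] → (a + d) ≡ t [mod2l l ]
  mod2l-+ {d} 2l∣d a t a≡t = subst (modulus l ∣ᵤ_) (sym (-+-comm a t d))
    (∣⇒∣ᵤ (∣m∣n⇒∣m+n {m = a - t} (∣ᵤ⇒∣ a≡t) 2l∣d))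

  leftEnd-+ : ∀ {d} → modulus l ∣ₛ d → ∀ {i} y → LeftEnd l i y → LeftEnd l i (y + d)
  leftEnd-+ {d} 2l∣d {i} y (inj₁ m) =
    inj₁ (subst (_≡ + i [mod2l l ]) (sym (+1-+-comm y d)) (mod2l-+ 2l∣d (y + + 1) (+ i) m))
  leftEnd-+ {d} 2l∣d {i} y (inj₂ m) =
    inj₂ (subst (_≡ - (+ i) [mod2l l ]) (sym (+1-+-comm y d)) (mod2l-+ 2l∣d (y + + 1) (- (+ i)) m))

  rightEnd-+ : ∀ {d} → modulus l ∣ₛ d → ∀ {i} y → RightEnd l i y → RightEnd l i (y + d)
  rightEnd-+ {d} 2l∣d {i} y r = subst (LeftEnd l i) (sym (-1-+-comm y d)) (leftEnd-+ 2l∣d (y - + 1) r)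

  leftEnd-+⁻ : ∀ {d} → modulus l ∣ₛ d → ∀ {i} y → LeftEnd l i (y + d) → LeftEnd l i y
  leftEnd-+⁻ {d} 2l∣d {i} y e =
    subst (LeftEnd l i) (+-neg-cancelʳ y d) (leftEnd-+ (∣m⇒∣-m 2l∣d) (y + d) e)

  rightEnd-+⁻ : ∀ {d} → modulus l ∣ₛ d → ∀ {i} y → RightEnd l i (y + d) → RightEnd l i y
  rightEnd-+⁻ {d} 2l∣d {i} y e =
    subst (RightEnd l i) (+-neg-cancelʳ y d) (rightEnd-+ (∣m⇒∣-m 2l∣d) (y + d) e)

  s-shiftClosed : ∀ {d} → modulus l ∣ₛ d → ∀ {i S} → ShiftClosed d S → ShiftClosed d (s l i S)
  s-shiftClosed {d} 2l∣d {S = S} closed y (inj₁ (le , Sy+1)) =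
    inj₁ (leftEnd-+ 2l∣d y le , subst S (sym (+1-+-comm y d)) (closed (y + + 1) Sy+1))
  s-shiftClosed {d} 2l∣d {S = S} closed y (inj₂ (inj₁ (re , Sy-1))) =
    inj₂ (inj₁ (rightEnd-+ 2l∣d y re , subst S (sym (-1-+-comm y d)) (closed (y - + 1) Sy-1)))
  s-shiftClosed 2l∣d closed y (inj₂ (inj₂ (¬le , ¬re , Sy))) =
    inj₂ (inj₂ ( (λ le → ¬le (leftEnd-+⁻ 2l∣d y le))
               , (λ re → ¬re (rightEnd-+⁻ 2l∣d y re))
               , closed y Sy))

  applyWord-shiftClosed : ∀ {d} → modulus l ∣ₛ d → ∀ w {S} →
    ShiftClosed d S → ShiftClosed d (applyWord l w S)
  applyWord-shiftClosed 2l∣d []      closed = closed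
  applyWord-shiftClosed 2l∣d (i ∷ w) closed =
    s-shiftClosed 2l∣d (applyWord-shiftClosed 2l∣d w closed)

Zlt-shiftClosed : ∀ {d} j → d ≤ 0ℤ → ShiftClosed d (Zlt j)
Zlt-shiftClosed j d≤0 x x<j =
  ≤-<-trans (≤-trans (+-monoʳ-≤ x d≤0) (≤-reflexive (+-identityʳ x))) x<j

core-shiftClosed : ∀ l μ j {d} → IsCoreC l μ j → modulus l ∣ₛ d → d ≤ 0ℤ →
  ShiftClosed d (β μ j)
core-shiftClosed l μ j (w , β≐orbit) 2l∣d d≤0 x βx =
  proj₂ (β≐orbit _)
    (applyWord-shiftClosed l 2l∣d w (Zlt-shiftClosed j d≤0) x (proj₁ (β≐orbit x) βx))

lemma3p15 : (l : ℕ) → l ≥ 2 → (j : ℤ) → (μ : Partition) → IsCoreC l μ j →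
    (∀ (i : ℤ) → β μ j i → β μ j (i - + (2 Data.Nat.* l)))
    × (∀ (i : ℤ) → ¬ β μ j i → ¬ β μ j (i + + (2 Data.Nat.* l)))
lemma3p15 l _ j μ core = bead-below , empty-above
  where
  bead-below : ∀ i → β μ j i → β μ j (i - modulus l)
  bead-below = core-shiftClosed l μ j core (∣m⇒∣-m ∣-refl) (neg-≤-pos {n = 0})

  empty-above : ∀ i → ¬ β μ j i → ¬ β μ j (i + modulus l)
  empty-above i ¬βi βi+2l =
    ¬βi (subst (β μ j) (+-minus-cancelʳ i (modulus l)) (bead-below (i + modulus l) βi+2l))
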